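{- Let $\star$ be either the Boolean sum ($i\star j=i+j \bmod 2$) or the second projection ($i\star j=j$) on $\{0,1\}$. Let $u,u'$ be uniformly recurrent, non-constant words with domain $\mathbb{N}$ over $\{0,1\}$ such that $\mathrm{fac}(u)\notin\{\mathrm{fac}(u'),\ \mathrm{fac}(u')^d,\ \mathrm{fac}(u')\dot+\mathbf{1},\ \mathrm{fac}(u')^d\dot+\mathbf{1}\}$. Then the ages of $\widehat G_{(u,\star)}$ and $\widehat G_{(u',\star)}$ are incomparable with respect to set inclusion.
   Context: A word $u$ with domain $\mathbb{N}$ over $\{0,1\}$ is uniformly recurrent if for every $n$ there is $m$ such that every factor (block of consecutive letters) of length $n$ occurs in every factor of length $m$. $\mathrm{fac}(u)$ is the set of finite factors of $u$. For a finite word $v=v_0\cdots v_{n-1}$, $v^d=v_{n-1}\cdots v_0$ and $v\dot+\mathbf{1}=(v_0\dot+1)\cdots(v_{n-1}\dot+1)$ with $\dot+$ addition mod $2$; for a set $X$ of words, $X^d=\{v^d:v\in X\}$, $X\dot+\mathbf{1}=\{v\dot+\mathbf 1: v\in X\}$, and $X^d\dot+\mathbf1=(X^d)\dot+\mathbf1$. $G_{(u,\star)}$ is the labelled graph on $\mathbb{N}\times\mathbb{N}$, vertex $(i,n)$ labelled $u(n)$, where $(i,n)\sim(i,m)$ iff $|n-m|=1$, and for $i<j$, $(i,n)\sim(j,m)$ iff $u(n)\star u(m)=1$; $\widehat G_{(u,\star)}$ is the graph obtained by forgetting the labels. The age of a graph is the class of finite graphs (up to isomorphism) isomorphic to induced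 subgraphs of it. -}

module Defs where

open import Data.Bool using (Bool; true; false; not; _xor_)
open import Data.Nat using (ℕ; zero; suc; _+_; _≤_; _<_)
open import Data.List using (List; map; reverse; length; upTo)
open import Data.Product using (Σ; _×_; _,_; ∃; ∃-syntax)
open import Data.Sum using (_⊎_)
open import Data.Fin using (Fin)
open import Relation.Binary.PropositionalEquality using (_≡_)
open import Relation.Nullary using (¬_)
open import Function.Definitions using (Injective)

-- Words with domain ℕ over {0,1}; letter 1 is 'true', 0 is 'false'.
Word : Set
Word = ℕ → Bool

window : Word → ℕ → ℕ → List Bool
window u i n = map (λ k → u (i + k)) (upTo n)

fac : Word → List Bool → Set
fac u w = ∃[ i ] window u i (length w) ≡ w

UniformlyRecurrent : Word → Set
UniformlyRecurrent u =
  ∀ n → ∃[ m ] ∀ i j → ∃[ k ] (k + n ≤ m × window u (j + k) n ≡ window u i n)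

Constant : Word → Set
Constant u = ∀ n → u n ≡ u 0

WordSet : Set₁
WordSet = List Bool → Set

_ᵈ : WordSet → WordSet
(X ᵈ) w = ∃[ v ] (X v × w ≡ reverse v)

_∔𝟏 : WordSet → WordSet
(X ∔𝟏) w = ∃[ v ] (X v × w ≡ map not v)

_≐_ : WordSet → WordSet → Set
X ≐ Y = ∀ w → (X w → Y w) × (Y w → X w)

data Star : Set where
  boolSum proj2 : Star

⟦_⟧ : Star → Bool → Bool → Bool
⟦ boolSum ⟧ i j = i xor j
⟦ proj2 ⟧ i j = j

_∸abs_ : ℕ → ℕ → ℕ
zero ∸abs m = m
suc n ∸abs zero = suc n
suc n ∸abs suc m = n ∸abs m

Adj : Star → Word → ℕ × ℕ → ℕ × ℕ → Set
Adj s u (i , n) (j , m) =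
    (i ≡ j × n ∸abs m ≡ 1)
  ⊎ (i < j × ⟦ s ⟧ (u n) (u m) ≡ true)
  ⊎ (j < i × ⟦ s ⟧ (u m) (u n) ≡ true)

record FinGraph : Set₁ where
  field
    size  : ℕ
    E     : Fin size → Fin size → Set
    sym   : ∀ {x y} → E x y → E y x
    irrefl : ∀ {x} → ¬ E x x

-- H belongs to the age of a graph (V, A): H is isomorphic to an induced
-- subgraph, i.e. there is an injective map preserving and reflecting adjacency
InAge : FinGraph → {V : Set} → (V → V → Set) → Set
InAge H {V} A =
  Σ (Fin (FinGraph.size H) → V) λ f →
    Injective _≡_ _≡_ f ×
    (∀ x y → (FinGraph.E H x y → A (f x) (f y)) × (A (f x) (f y) → FinGraph.E H x y))

AgeSub : {V : Set} → (V → V → Set) → {W : Set} → (W → W → Set) → Set₁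
AgeSub A B = ∀ H → InAge H A → InAge H B

Ĝ : Star → Word → ℕ × ℕ → ℕ × ℕ → Set
Ĝ = Adj

module Submission where

-- Suppose Age(Ĝ(u,⋆)) ⊆ Age(Ĝ(u′,⋆)). For each n, copy into Ĝ(u′,⋆) the finite "fan" of Ĝ(u,⋆)
-- formed by the stretch (1,0), …, (1,L−1) of row 1 and the hub (0,0), which is joined to (1,k)
-- exactly when u(0) ⋆ u(k) = 1. By uniform recurrence this adjacency pattern takes both values in
-- every short window, and that forces the copied path to run along a single row of Ĝ(u′,⋆), in one
-- direction, with the hub in another row. Reading labels along the path shows that u on [0, L) is a
-- segment of u′, possibly reversed and/or complemented; for L large, [0, L) contains every factor of
-- u of length n. Antitonicity in n makes one of the four symmetries work for all n, and uniform
-- recurrence of u′ then turns the inclusion of factor sets into an equality, which is excluded.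

open import Defs
open import Data.Bool using (Bool; true; false; not; _xor_)
open import Data.Bool.Properties using (not-involutive; not-injective; ¬-not) renaming (_≟_ to _≟ᴮ_)
open import Data.Nat using (ℕ; zero; suc; _+_; _∸_; _⊔_; _≤_; _<_; z≤n; s≤s; z<s; _≟_; _<?_; _≤?_)
open import Data.Nat.Properties
open import Data.List using (List; []; _∷_; _++_; map; reverse; length; applyUpTo; applyDownFrom)
open import Data.List.Properties
  using (map-upTo; map-applyUpTo; reverse-applyUpTo; length-applyUpTo; length-++; length-map; length-reverse;
         map-++; reverse-++; reverse-map; reverse-involutive; ++-assoc; ∷-injective; ≡-dec)
open import Data.Fin using (Fin; zero; suc; toℕ; fromℕ<)
open import Data.Fin.Properties using (any?; toℕ-fromℕ<; toℕ-injective)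
import Data.Fin.Properties as Fin
open import Data.Product using (Σ; ∃; ∃₂; ∃-syntax; _×_; _,_; proj₁; proj₂)
open import Data.Sum using (_⊎_; inj₁; inj₂)
import Data.Sum as Sum
open import Data.Empty using (⊥; ⊥-elim)
open import Function.Base using (_∘′_)
open import Algebra.Properties.CommutativeSemigroup +-commutativeSemigroup using (x∙yz≈xz∙y)
open import Function.Bundles using (_⇔_; mk⇔; Equivalence)
open import Function.Construct.Composition using (_⇔-∘_)
open import Function.Construct.Symmetry using (⇔-sym)
open import Function.Definitions using (Injective)
open import Relation.Binary.PropositionalEquality
open import Relation.Nullary using (¬_; Dec; yes; no; contradiction)
open import Relation.Binary.Definitions using (tri<; tri≈; tri>)
open import Relation.Nullary.Negation using (Stable)
open import Relation.Nullary.Decidable using (decidable-stable)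
import Relation.Nullary.Decidable as Dec

open Equivalence using (to; from)

m≤m+n+o+p : ∀ m n o p → m ≤ m + n + o + p
m≤m+n+o+p m n o p = ≤-trans (m≤m+n m n) (≤-trans (m≤m+n (m + n) o) (m≤m+n (m + n + o) p))

∸abs-self : ∀ n → n ∸abs n ≡ 0
∸abs-self zero    = refl
∸abs-self (suc n) = ∸abs-self n

∸abs-sym : ∀ m n → m ∸abs n ≡ n ∸abs m
∸abs-sym zero    zero    = refl
∸abs-sym zero    (suc n) = refl
∸abs-sym (suc m) zero    = refl
∸abs-sym (suc m) (suc n) = ∸abs-sym m n

∸abs-suc : ∀ n → n ∸abs suc n ≡ 1
∸abs-suc zero    = refl
∸abs-suc (suc n) = ∸abs-suc n

∸abs≡1⇒ : ∀ m n → m ∸abs n ≡ 1 → n ≡ suc m ⊎ m ≡ suc n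
∸abs≡1⇒ zero          (suc zero) _ = inj₁ refl
∸abs≡1⇒ (suc zero)    zero       _ = inj₂ refl
∸abs≡1⇒ (suc m)       (suc n)    d = Sum.map (cong suc) (cong suc) (∸abs≡1⇒ m n d)

apart⇒∸abs≢1 : ∀ {m n} → suc m < n ⊎ suc n < m → m ∸abs n ≢ 1
apart⇒∸abs≢1 {m} {n} apart d with ∸abs≡1⇒ m n d | apart
... | inj₁ refl | inj₁ m+1<m+1 = <-irrefl refl m+1<m+1
... | inj₁ refl | inj₂ m+2<m   = <-asym (<-trans (n<1+n m) (n<1+n (suc m))) m+2<m
... | inj₂ refl | inj₁ n+2<n   = <-asym (<-trans (n<1+n n) (n<1+n (suc n))) n+2<n
... | inj₂ refl | inj₂ n+1<n+1 = <-irrefl refl n+1<n+1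

∸abs≡1-at-most-two : ∀ q {p₁ p₂ p₃} → q ∸abs p₁ ≡ 1 → q ∸abs p₂ ≡ 1 → q ∸abs p₃ ≡ 1 →
                     p₁ ≡ p₂ ⊎ p₂ ≡ p₃ ⊎ p₁ ≡ p₃
∸abs≡1-at-most-two q {p₁} {p₂} {p₃} d₁ d₂ d₃
  with ∸abs≡1⇒ q p₁ d₁ | ∸abs≡1⇒ q p₂ d₂ | ∸abs≡1⇒ q p₃ d₃
... | inj₁ e₁ | inj₁ e₂ | _       = inj₁ (trans e₁ (sym e₂))
... | inj₂ e₁ | inj₂ e₂ | _       = inj₁ (suc-injective (trans (sym e₁) e₂))
... | inj₁ e₁ | inj₂ e₂ | inj₁ e₃ = inj₂ (inj₂ (trans e₁ (sym e₃)))
... | inj₁ e₁ | inj₂ e₂ | inj₂ e₃ = inj₂ (inj₁ (suc-injective (trans (sym e₂) e₃)))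
... | inj₂ e₁ | inj₁ e₂ | inj₁ e₃ = inj₂ (inj₁ (trans e₂ (sym e₃)))
... | inj₂ e₁ | inj₁ e₂ | inj₂ e₃ = inj₂ (inj₂ (suc-injective (trans (sym e₁) e₃)))

step-constant : ∀ {A : Set} (f : ℕ → A) {lo hi} → (∀ {t} → lo ≤ t → suc t < hi → f t ≡ f (suc t)) →
                ∀ {t} → lo ≤ t → t < hi → f t ≡ f lo
step-constant f step {t = t} lo≤t t<hi with m≤n⇒m<n∨m≡n lo≤t
step-constant f step {t = t}     lo≤t t<hi | inj₂ refl        = refl
step-constant f step {t = suc t} lo≤t t<hi | inj₁ (s≤s lo≤t′) =
  trans (sym (step lo≤t′ t<hi)) (step-constant f step lo≤t′ (<-trans (n<1+n t) t<hi))

unit-steps⇒affine : ∀ (p : ℕ → ℕ) L →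
                    (∀ {k} → suc k < L → p (suc k) ≡ suc (p k) ⊎ p k ≡ suc (p (suc k))) →
                    (∀ {k} → suc (suc k) < L → p (suc (suc k)) ≢ p k) →
                    (∀ {k} → k < L → p k ≡ p 0 + k) ⊎ (∀ {k} → k < L → p k + k ≡ p 0)
unit-steps⇒affine p L step no-return with 1 <? L
... | no 1≮L = inj₁ (λ k<L → subst (λ j → p j ≡ p 0 + j) (sym (n<1⇒n≡0 (<-≤-trans k<L (≮⇒≥ 1≮L))))
                                 (sym (+-identityʳ (p 0))))
... | yes 1<L with step 1<L
...   | inj₁ up   = inj₁ (ascending up)
  where
  up-step : p 1 ≡ suc (p 0) → ∀ {k} → suc k < L → p (suc k) ≡ suc (p k)
  up-step up {zero}  _     = up
  up-step up {suc k} k+2<L with step k+2<L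
  ... | inj₁ e = e
  ... | inj₂ e = contradiction (suc-injective (trans (sym e) (up-step up (<-trans (n<1+n (suc k)) k+2<L)))) (no-return k+2<L)
  ascending : p 1 ≡ suc (p 0) → ∀ {k} → k < L → p k ≡ p 0 + k
  ascending up {zero}  _     = sym (+-identityʳ (p 0))
  ascending up {suc k} k+1<L =
    trans (up-step up k+1<L) (trans (cong suc (ascending up (<-trans (n<1+n k) k+1<L))) (sym (+-suc (p 0) k)))
...   | inj₂ down = inj₂ (descending down)
  where
  down-step : p 0 ≡ suc (p 1) → ∀ {k} → suc k < L → p k ≡ suc (p (suc k))
  down-step down {zero}  _     = down
  down-step down {suc k} k+2<L with step k+2<L
  ... | inj₂ e = e
  ... | inj₁ e = contradiction (trans e (sym (down-step down (<-trans (n<1+n (suc k)) k+2<L)))) (no-return k+2<L)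
  descending : p 0 ≡ suc (p 1) → ∀ {k} → k < L → p k + k ≡ p 0
  descending down {zero}  _     = +-identityʳ (p 0)
  descending down {suc k} k+1<L =
    trans (+-suc (p (suc k)) k) (trans (cong (_+ k) (sym (down-step down k+1<L))) (descending down (<-trans (n<1+n k) k+1<L)))

mirror : Bool → ℕ → ℕ → ℕ
mirror false n t = t
mirror true  n t = n ∸ suc t

affine⇒windows : ∀ (p : ℕ → ℕ) L →
                 (∀ {k} → k < L → p k ≡ p 0 + k) ⊎ (∀ {k} → k < L → p k + k ≡ p 0) →
                 ∃[ r ] ∀ {q n} → q + n ≤ L → ∃[ P ] ∀ {t} → t < n → p (q + t) ≡ P + mirror r n t
affine⇒windows p L (inj₁ ascending) = false , λ {q} q+n≤L →
  p 0 + q , λ {t} t<n → trans (ascending (<-≤-trans (+-monoʳ-< q t<n) q+n≤L)) (sym (+-assoc (p 0) q t))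
affine⇒windows p L (inj₂ descending) = true , window-start
  where
  window-start : ∀ {q n} → q + n ≤ L → ∃[ P ] ∀ {t} → t < n → p (q + t) ≡ P + mirror true n t
  window-start {q} {zero}  _       = 0 , λ ()
  window-start {q} {suc m} q+m+1≤L = p (q + m) , λ {t} t<m+1 → +-cancelʳ-≡ (q + t) _ _ (begin
      p (q + t) + (q + t)                  ≡⟨ descending (<-≤-trans (+-monoʳ-< q t<m+1) q+m+1≤L) ⟩
      p 0                                  ≡⟨ sym (descending (<-≤-trans (+-monoʳ-< q (n<1+n m)) q+m+1≤L)) ⟩
      p (q + m) + (q + m)                  ≡⟨ cong (p (q + m) +_) (sym (trans (+-assoc q t (m ∸ t))
                                                                            (cong (q +_) (m+[n∸m]≡n (≤-pred t<m+1))))) ⟩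
      p (q + m) + ((q + t) + (m ∸ t))      ≡⟨ x∙yz≈xz∙y (p (q + m)) (q + t) (m ∸ t) ⟩
      p (q + m) + (m ∸ t) + (q + t)        ∎)
    where open ≡-Reasoning

false≢true : false ≢ true
false≢true ()

xor≡true⇔≢ : ∀ x y → x xor y ≡ true ⇔ x ≢ y
xor≡true⇔≢ false false = mk⇔ (λ ()) (λ x≢x → contradiction refl x≢x)
xor≡true⇔≢ false true  = mk⇔ (λ _ ()) (λ _ → refl)
xor≡true⇔≢ true  false = mk⇔ (λ _ ()) (λ _ → refl)
xor≡true⇔≢ true  true  = mk⇔ (λ ()) (λ x≢x → contradiction refl x≢x)

≡true-equivalent⇒≡ : ∀ {x y} → (x ≡ true → y ≡ true) → (y ≡ true → x ≡ true) → x ≡ y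
≡true-equivalent⇒≡ {false} {false} _ _ = refl
≡true-equivalent⇒≡ {false} {true}  _ y⇒x = y⇒x refl
≡true-equivalent⇒≡ {true}  {false} x⇒y _ = sym (x⇒y refl)
≡true-equivalent⇒≡ {true}  {true}  _ _ = refl

xor-cancelʳ : ∀ x y → x ≡ (x xor y) xor y
xor-cancelʳ false false = refl
xor-cancelʳ false true  = refl
xor-cancelʳ true  false = refl
xor-cancelʳ true  true  = refl

xor-flip : ∀ x y → not x ≡ (x xor y) xor not y
xor-flip false false = refl
xor-flip false true  = refl
xor-flip true  false = refl
xor-flip true  true  = refl

xor-determined : ∀ {P : ℕ → Set} (f g : ℕ → Bool) → (∀ {i j} → P i → P j → g i ≡ g j → f i ≡ f j) →
                 ∀ {i₀ j₀} → P i₀ → P j₀ → f i₀ ≢ f j₀ → ∃[ b ] ∀ {k} → P k → f k ≡ b xor g k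
xor-determined {P} f g by-g {i₀} {j₀} P-i₀ P-j₀ f≢ = b , λ P-k → by-cases P-k (g _ ≟ᴮ g i₀)
  where
  b : Bool
  b = f i₀ xor g i₀
  by-cases : ∀ {k} → P k → Dec (g k ≡ g i₀) → f k ≡ b xor g k
  by-cases {k} P-k (yes g≡) = trans (by-g P-k P-i₀ g≡) (trans (xor-cancelʳ (f i₀) (g i₀)) (cong (b xor_) (sym g≡)))
  by-cases {k} P-k (no  g≢) = begin
    f k              ≡⟨ by-g P-k P-j₀ (trans (¬-not g≢) (sym (¬-not (f≢ ∘′ by-g P-i₀ P-j₀ ∘′ sym)))) ⟩
    f j₀             ≡⟨ ¬-not (f≢ ∘′ sym) ⟩
    not (f i₀)       ≡⟨ xor-flip (f i₀) (g i₀) ⟩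
    b xor not (g i₀) ≡⟨ cong (b xor_) (sym (¬-not g≢)) ⟩
    b xor g k        ∎
    where open ≡-Reasoning

⟦⟧-injective : ∀ s e {x y} → ⟦ s ⟧ e x ≡ ⟦ s ⟧ e y → x ≡ y
⟦⟧-injective boolSum false eq = eq
⟦⟧-injective boolSum true  eq = not-injective eq
⟦⟧-injective proj2   _     eq = eq

applyUpTo-cong : ∀ {A : Set} {f g : ℕ → A} n → (∀ {k} → k < n → f k ≡ g k) →
                 applyUpTo f n ≡ applyUpTo g n
applyUpTo-cong zero    f≗g = refl
applyUpTo-cong (suc n) f≗g = cong₂ _∷_ (f≗g (s≤s z≤n)) (applyUpTo-cong n (λ k<n → f≗g (s≤s k<n)))

applyUpTo-+ : ∀ {A : Set} (f : ℕ → A) m n →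
              applyUpTo f (m + n) ≡ applyUpTo f m ++ applyUpTo (λ k → f (m + k)) n
applyUpTo-+ f zero    n = refl
applyUpTo-+ f (suc m) n = cong (f 0 ∷_) (applyUpTo-+ (λ k → f (suc k)) m n)

applyDownFrom-applyUpTo : ∀ {A : Set} (f : ℕ → A) n → applyDownFrom f n ≡ applyUpTo (λ t → f (n ∸ suc t)) n
applyDownFrom-applyUpTo f zero    = refl
applyDownFrom-applyUpTo f (suc n) = cong (f n ∷_) (applyDownFrom-applyUpTo f n)

window-applyUpTo : ∀ u i n → window u i n ≡ applyUpTo (λ k → u (i + k)) n
window-applyUpTo u i = map-upTo (λ k → u (i + k))

length-window : ∀ u i n → length (window u i n) ≡ n
length-window u i n = trans (cong length (window-applyUpTo u i n)) (length-applyUpTo _ n)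

window-+ : ∀ u i m n → window u i (m + n) ≡ window u i m ++ window u (i + m) n
window-+ u i m n = begin
  window u i (m + n)                                                    ≡⟨ window-applyUpTo u i (m + n) ⟩
  applyUpTo (λ k → u (i + k)) (m + n)                                   ≡⟨ applyUpTo-+ _ m n ⟩
  applyUpTo (λ k → u (i + k)) m ++ applyUpTo (λ k → u (i + (m + k))) n
    ≡⟨ cong₂ _++_ (sym (window-applyUpTo u i m)) shift ⟩
  window u i m ++ window u (i + m) n                                    ∎
  where
  open ≡-Reasoning
  shift : applyUpTo (λ k → u (i + (m + k))) n ≡ window u (i + m) n
  shift = trans (applyUpTo-cong n (λ {k} _ → cong u (sym (+-assoc i m k)))) (sym (window-applyUpTo u (i + m) n))

infix 4 _⊑_
_⊑_ : List Bool → List Bool → Set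
x ⊑ y = ∃₂ λ pre suf → y ≡ pre ++ x ++ suf

window-⊑ : ∀ u i {k n m} → k + n ≤ m → window u (i + k) n ⊑ window u i m
window-⊑ u i {k} {n} {m} k+n≤m = window u i k , window u (i + k + n) (m ∸ (k + n)) , (begin
  window u i m
    ≡⟨ cong (window u i) (sym (trans (sym (+-assoc k n _)) (m+[n∸m]≡n k+n≤m))) ⟩
  window u i (k + (n + (m ∸ (k + n))))         ≡⟨ window-+ u i k _ ⟩
  window u i k ++ window u (i + k) (n + (m ∸ (k + n))) ≡⟨ cong (window u i k ++_) (window-+ u (i + k) n _) ⟩
  window u i k ++ window u (i + k) n ++ window u (i + k + n) (m ∸ (k + n)) ∎)
  where open ≡-Reasoning

++-cancel-prefix : ∀ (a c : List Bool) {b d} → length a ≡ length c → a ++ b ≡ c ++ d → a ≡ c × b ≡ d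
++-cancel-prefix []      []      _     eq = refl , eq
++-cancel-prefix (x ∷ a) (y ∷ c) |a|≡|c| eq with ∷-injective eq
... | refl , eq′ with ++-cancel-prefix a c (suc-injective |a|≡|c|) eq′
... | refl , eq″ = refl , eq″

fac-⊑ : ∀ u {x y} → x ⊑ y → fac u y → fac u x
fac-⊑ u {x} (pre , suf , refl) (i , occ) =
  j , proj₁ (++-cancel-prefix (window u j (length x)) x (length-window u j (length x)) middle)
  where
  j : ℕ
  j = i + length pre
  split : window u i (length (pre ++ x ++ suf))
        ≡ window u i (length pre) ++ window u j (length x) ++ window u (j + length x) (length suf)
  split = begin
    window u i (length (pre ++ x ++ suf))
      ≡⟨ cong (window u i) (trans (length-++ pre) (cong (length pre +_) (length-++ x))) ⟩
    window u i (length pre + (length x + length suf))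
      ≡⟨ window-+ u i (length pre) _ ⟩
    window u i (length pre) ++ window u j (length x + length suf)
      ≡⟨ cong (window u i (length pre) ++_) (window-+ u j (length x) (length suf)) ⟩
    window u i (length pre) ++ window u j (length x) ++ window u (j + length x) (length suf) ∎
    where open ≡-Reasoning
  middle : window u j (length x) ++ window u (j + length x) (length suf) ≡ x ++ suf
  middle = proj₂ (++-cancel-prefix (window u i (length pre)) pre (length-window u i (length pre))
                                    (trans (sym split) occ))

window-occurs : ∀ u i n → fac u (window u i n)
window-occurs u i n = i , cong (window u i) (length-window u i n)

recurrence-⊑ : ∀ u → UniformlyRecurrent u → ∀ n → ∃[ m ] ∀ {x y} →
               fac u x → length x ≡ n → fac u y → length y ≡ m → x ⊑ y
recurrence-⊑ u ur n = m , occurs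
  where
  m : ℕ
  m = proj₁ (ur n)
  occurs : ∀ {x y} → fac u x → length x ≡ n → fac u y → length y ≡ m → x ⊑ y
  occurs {x} {y} (i , occ-x) refl (j , occ-y) |y|≡m with proj₂ (ur n) i j
  ... | k , k+n≤m , eq =
    subst₂ _⊑_ (trans eq occ-x) (trans (cong (window u j) (sym |y|≡m)) occ-y) (window-⊑ u j k+n≤m)

letter-recurrence : ∀ u → UniformlyRecurrent u → ∃[ B ] ∀ i j → ∃[ k ] k < B × u (j + k) ≡ u i
letter-recurrence u ur = proj₁ (ur 1) , λ i j → letter i j
  where
  letter : ∀ i j → ∃[ k ] k < proj₁ (ur 1) × u (j + k) ≡ u i
  letter i j with proj₂ (ur 1) i j
  ... | k , k+1≤B , eq = k , subst (_≤ proj₁ (ur 1)) (+-comm k 1) k+1≤B ,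
                         trans (cong u (sym (+-identityʳ (j + k))))
                               (trans (proj₁ (∷-injective eq)) (cong u (+-identityʳ i)))

fac-dec : ∀ u → UniformlyRecurrent u → ∀ w → Dec (fac u w)
fac-dec u ur w = Dec.map (mk⇔ fromFin toFin) (any? (λ k → ≡-dec _≟ᴮ_ (window u (toℕ k) (length w)) w))
  where
  n m : ℕ
  n = length w
  m = proj₁ (ur n)
  fromFin : ∃ (λ (k : Fin (suc m)) → window u (toℕ k) n ≡ w) → fac u w
  fromFin (k , eq) = toℕ k , eq
  toFin : fac u w → ∃ (λ (k : Fin (suc m)) → window u (toℕ k) n ≡ w)
  toFin (i , eq) with proj₂ (ur n) i 0
  ... | k , k+n≤m , eq′ = fromℕ< (s≤s (≤-trans (m≤m+n k n) k+n≤m)) ,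
                          trans (cong (λ j → window u j n) (toℕ-fromℕ< _)) (trans eq′ eq)

fac-stable : ∀ u → UniformlyRecurrent u → ∀ w → Stable (fac u w)
fac-stable u ur w = decidable-stable (fac-dec u ur w)

-- Reversal and complement

-- (r , b) reverses when r and complements when b; image is the matching operation on sets of words.
Symmetry : Set
Symmetry = Bool × Bool

orient : Bool → List Bool → List Bool
orient false w = w
orient true  w = reverse w

complement : Bool → List Bool → List Bool
complement false w = w
complement true  w = map not w

act : Symmetry → List Bool → List Bool
act (r , b) w = orient r (complement b w)

reflectSet : Bool → WordSet → WordSet
reflectSet false X = X
reflectSet true  X = X ᵈ

complementSet : Bool → WordSet → WordSet
complementSet false X = X
complementSet true  X = X ∔𝟏

image : Symmetry → WordSet → WordSet
image (r , b) X = complementSet b (reflectSet r X)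

map-not-involutive : ∀ w → map not (map not w) ≡ w
map-not-involutive []      = refl
map-not-involutive (x ∷ w) = cong₂ _∷_ (not-involutive x) (map-not-involutive w)

orient-involutive : ∀ r w → orient r (orient r w) ≡ w
orient-involutive false w = refl
orient-involutive true  w = reverse-involutive w

complement-involutive : ∀ b w → complement b (complement b w) ≡ w
complement-involutive false w = refl
complement-involutive true  w = map-not-involutive w

orient-complement : ∀ r b w → orient r (complement b w) ≡ complement b (orient r w)
orient-complement false b     w = refl
orient-complement true  false w = refl
orient-complement true  true  w = sym (reverse-map not w)

act-involutive : ∀ σ w → act σ (act σ w) ≡ w
act-involutive (r , b) w = begin
  orient r (complement b (orient r (complement b w))) ≡⟨ cong (orient r ∘′ complement b) (orient-complement r b w) ⟩
  orient r (complement b (complement b (orient r w))) ≡⟨ cong (orient r) (complement-involutive b (orient r w)) ⟩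
  orient r (orient r w)                               ≡⟨ orient-involutive r w ⟩
  w                                                   ∎
  where open ≡-Reasoning

length-act : ∀ σ w → length (act σ w) ≡ length w
length-act (false , false) w = refl
length-act (false , true)  w = length-map not w
length-act (true  , false) w = length-reverse w
length-act (true  , true)  w = trans (length-reverse (map not w)) (length-map not w)

act-⊑ : ∀ σ {x y} → x ⊑ y → act σ x ⊑ act σ y
act-⊑ (r , b) = orient-⊑ r ∘′ complement-⊑ b
  where
  complement-⊑ : ∀ b {x y} → x ⊑ y → complement b x ⊑ complement b y
  complement-⊑ false x⊑y = x⊑y
  complement-⊑ true  {x} (pre , suf , refl) =
    map not pre , map not suf , trans (map-++ not pre (x ++ suf)) (cong (map not pre ++_) (map-++ not x suf))
  orient-⊑ : ∀ r {x y} → x ⊑ y → orient r x ⊑ orient r y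
  orient-⊑ false x⊑y = x⊑y
  orient-⊑ true  {x} (pre , suf , refl) =
    reverse suf , reverse pre ,
    trans (reverse-++ pre (x ++ suf))
          (trans (cong (_++ reverse pre) (reverse-++ x suf)) (++-assoc (reverse suf) (reverse x) (reverse pre)))

reflectSet-orient : ∀ r X w → reflectSet r X w ⇔ X (orient r w)
reflectSet-orient false X w = mk⇔ (λ x → x) (λ x → x)
reflectSet-orient true  X w =
  mk⇔ (λ { (v , x , refl) → subst X (sym (reverse-involutive v)) x }) (λ x → reverse w , x , sym (reverse-involutive w))

complementSet-complement : ∀ b X w → complementSet b X w ⇔ X (complement b w)
complementSet-complement false X w = mk⇔ (λ x → x) (λ x → x)
complementSet-complement true  X w =
  mk⇔ (λ { (v , x , refl) → subst X (sym (map-not-involutive v)) x }) (λ x → map not w , x , sym (map-not-involutive w))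

image-act : ∀ σ X w → image σ X w ⇔ X (act σ w)
image-act (r , b) X w = reflectSet-orient r X (complement b w) ⇔-∘ complementSet-complement b (reflectSet r X) w

orient-applyUpTo : ∀ r (f : ℕ → Bool) n → orient r (applyUpTo f n) ≡ applyUpTo (λ t → f (mirror r n t)) n
orient-applyUpTo false f n = refl
orient-applyUpTo true  f n = trans (reverse-applyUpTo f n) (applyDownFrom-applyUpTo f n)

complement-applyUpTo : ∀ b (f : ℕ → Bool) n → complement b (applyUpTo f n) ≡ applyUpTo (λ t → b xor f t) n
complement-applyUpTo false f n = refl
complement-applyUpTo true  f n = map-applyUpTo f not n

window-twisted : ∀ u u′ {q P n} r b → (∀ {t} → t < n → u (q + t) ≡ b xor u′ (P + mirror r n t)) →
                 act (r , b) (window u q n) ≡ window u′ P n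
window-twisted u u′ {q} {P} {n} r b twist = begin
  act (r , b) (window u q n)                                     ≡⟨ cong (act (r , b)) (window-applyUpTo u q n) ⟩
  act (r , b) (applyUpTo (λ t → u (q + t)) n)                    ≡⟨ cong (act (r , b)) (applyUpTo-cong n twist) ⟩
  act (r , b) (applyUpTo (λ t → b xor u′ (P + mirror r n t)) n)  ≡⟨ cong (act (r , b)) twisted ⟩
  act (r , b) (act (r , b) (window u′ P n))                      ≡⟨ act-involutive (r , b) (window u′ P n) ⟩
  window u′ P n                                                  ∎
  where
  open ≡-Reasoning
  twisted : applyUpTo (λ t → b xor u′ (P + mirror r n t)) n ≡ act (r , b) (window u′ P n)
  twisted = sym (begin
    orient r (complement b (window u′ P n))                  ≡⟨ cong (orient r ∘′ complement b) (window-applyUpTo u′ P n) ⟩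
    orient r (complement b (applyUpTo (λ t → u′ (P + t)) n)) ≡⟨ cong (orient r) (complement-applyUpTo b _ n) ⟩
    orient r (applyUpTo (λ t → b xor u′ (P + t)) n)          ≡⟨ orient-applyUpTo r _ n ⟩
    applyUpTo (λ t → b xor u′ (P + mirror r n t)) n          ∎)

≐-image-swap : ∀ {X Y : WordSet} σ → X ≐ image σ Y → Y ≐ image σ X
≐-image-swap {X} {Y} σ X≐Y w =
  (λ y → from (image-act σ X w) (proj₂ (X≐Y (act σ w)) (from (image-act σ Y (act σ w)) (subst Y (sym σσw≡w) y)))) ,
  (λ x → subst Y σσw≡w (to (image-act σ Y (act σ w)) (proj₁ (X≐Y (act σ w)) (to (image-act σ X w) x))))
  where
  σσw≡w : act σ (act σ w) ≡ w
  σσw≡w = act-involutive σ w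

-- Reading the factors of one word in another

Antitone : (ℕ → Set) → Set
Antitone P = ∀ {m n} → m ≤ n → P n → P m

-- Classically: one of P, Q holds for infinitely many n, hence, being antitone, for all n.
¬∀-⊎ : ∀ {P Q : ℕ → Set} → Antitone P → Antitone Q → (∀ n → Stable (P n)) →
       ¬ (∀ n → P n) → ¬ (∀ n → Q n) → ¬ (∀ n → P n ⊎ Q n)
¬∀-⊎ {P} {Q} P-antitone Q-antitone P-stable ¬∀P ¬∀Q P⊎Q =
  ¬∀P (λ n → P-stable n (λ ¬Pn → ¬∀Q (Q-beyond ¬Pn)))
  where
  Q-beyond : ∀ {n} → ¬ P n → ∀ m → Q m
  Q-beyond {n} ¬Pn m with P⊎Q (n ⊔ m)
  ... | inj₁ p = ⊥-elim (¬Pn (P-antitone (m≤m⊔n n m) p))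
  ... | inj₂ q = Q-antitone (m≤n⊔m n m) q

Reads : Word → Word → Symmetry → ℕ → Set
Reads u u′ σ n = ∀ i → fac u′ (act σ (window u i n))

Reads-antitone : ∀ u u′ σ → Antitone (Reads u u′ σ)
Reads-antitone u u′ σ {m} {n} m≤n reads i = fac-⊑ u′ (act-⊑ σ prefix) (reads i)
  where
  prefix : window u i m ⊑ window u i n
  prefix = subst (λ j → window u j m ⊑ window u i n) (+-identityʳ i) (window-⊑ u i {0} m≤n)

Reads-stable : ∀ u u′ → UniformlyRecurrent u′ → ∀ σ n → Stable (Reads u u′ σ n)
Reads-stable u u′ ur′ σ n ¬¬reads i = fac-stable u′ ur′ _ (λ ¬occ → ¬¬reads (λ reads → ¬occ (reads i)))

Reads-everywhere⇒fac≐image : ∀ u u′ σ → UniformlyRecurrent u′ → (∀ n → Reads u u′ σ n) →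
                               fac u ≐ image σ (fac u′)
Reads-everywhere⇒fac≐image u u′ σ ur′ reads w =
  (λ occ → from (image-act σ (fac u′) w) (forward occ)) , (λ img → backward (to (image-act σ (fac u′) w) img))
  where
  forward : ∀ {w} → fac u w → fac u′ (act σ w)
  forward {w} (i , occ) = subst (fac u′ ∘′ act σ) occ (reads (length w) i)
  m : ℕ
  m = proj₁ (recurrence-⊑ u′ ur′ (length w))
  y : List Bool
  y = window u 0 m
  backward : fac u′ (act σ w) → fac u w
  backward occ =
    fac-⊑ u (subst₂ _⊑_ (act-involutive σ w) (act-involutive σ y) (act-⊑ σ σw⊑σy)) (window-occurs u 0 m)
    where
    σw⊑σy : act σ w ⊑ act σ y
    σw⊑σy = proj₂ (recurrence-⊑ u′ ur′ (length w)) occ (length-act σ w) (forward (window-occurs u 0 m))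
                  (trans (length-act σ y) (length-window u 0 m))

¬∀∃-Reads : ∀ u u′ → UniformlyRecurrent u′ → (∀ σ → ¬ (∀ n → Reads u u′ σ n)) →
            ¬ (∀ n → ∃[ σ ] Reads u u′ σ n)
¬∀∃-Reads u u′ ur′ ¬reads reads =
  ¬∀-⊎ (antitone ff) (⊎-antitone (antitone ft) (⊎-antitone (antitone tf) (antitone tt))) (stable ff) (¬reads ff)
    (¬∀-⊎ (antitone ft) (⊎-antitone (antitone tf) (antitone tt)) (stable ft) (¬reads ft)
      (¬∀-⊎ (antitone tf) (antitone tt) (stable tf) (¬reads tf) (¬reads tt)))
    (λ n → as-sum (reads n))
  where
  R : Symmetry → ℕ → Set
  R = Reads u u′
  ff ft tf tt : Symmetry
  ff = false , false
  ft = false , true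
  tf = true , false
  tt = true , true
  antitone : ∀ σ → Antitone (R σ)
  antitone = Reads-antitone u u′
  stable : ∀ σ n → Stable (R σ n)
  stable = Reads-stable u u′ ur′
  ⊎-antitone : ∀ {P Q : ℕ → Set} → Antitone P → Antitone Q → Antitone (λ n → P n ⊎ Q n)
  ⊎-antitone P-antitone Q-antitone m≤n = Sum.map (P-antitone m≤n) (Q-antitone m≤n)
  as-sum : ∀ {n} → ∃[ σ ] R σ n → R ff n ⊎ R ft n ⊎ R tf n ⊎ R tt n
  as-sum ((false , false) , r) = inj₁ r
  as-sum ((false , true)  , r) = inj₂ (inj₁ r)
  as-sum ((true  , false) , r) = inj₂ (inj₂ (inj₁ r))
  as-sum ((true  , true)  , r) = inj₂ (inj₂ (inj₂ r))

module _ (s : Star) (z : Word) where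

  Adj-sym : ∀ {x y} → Adj s z x y → Adj s z y x
  Adj-sym {x} {y} (inj₁ (i≡j , d))   = inj₁ (sym i≡j , trans (∸abs-sym (proj₂ y) (proj₂ x)) d)
  Adj-sym         (inj₂ (inj₁ i<j)) = inj₂ (inj₂ i<j)
  Adj-sym         (inj₂ (inj₂ j<i)) = inj₂ (inj₁ j<i)

  Adj-irrefl : ∀ {x} → ¬ Adj s z x x
  Adj-irrefl {x} (inj₁ (_ , d))      with trans (sym (∸abs-self (proj₂ x))) d
  ... | ()
  Adj-irrefl     (inj₂ (inj₁ (i<i , _))) = <-irrefl refl i<i
  Adj-irrefl     (inj₂ (inj₂ (i<i , _))) = <-irrefl refl i<i

  Adj-row : ∀ {i n m} → Adj s z (i , n) (i , m) ⇔ n ∸abs m ≡ 1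
  Adj-row = mk⇔ (λ { (inj₁ (_ , d)) → d ; (inj₂ (inj₁ (i<i , _))) → ⊥-elim (<-irrefl refl i<i)
                   ; (inj₂ (inj₂ (i<i , _))) → ⊥-elim (<-irrefl refl i<i) })
                (λ d → inj₁ (refl , d))

  Adj-relabel : ∀ {i j n m m′} → i ≢ j → z m ≡ z m′ → Adj s z (i , n) (j , m) → Adj s z (i , n) (j , m′)
  Adj-relabel i≢j _ (inj₁ (i≡j , _)) = contradiction i≡j i≢j
  Adj-relabel {n = n} _ label (inj₂ (inj₁ (i<j , adj))) =
    inj₂ (inj₁ (i<j , subst (λ b → ⟦ s ⟧ (z n) b ≡ true) label adj))
  Adj-relabel {n = n} _ label (inj₂ (inj₂ (j<i , adj))) =
    inj₂ (inj₂ (j<i , subst (λ b → ⟦ s ⟧ b (z n) ≡ true) label adj))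

  Adj-upward : ∀ {i j n m} → i < j → Adj s z (i , n) (j , m) ⇔ ⟦ s ⟧ (z n) (z m) ≡ true
  Adj-upward i<j = mk⇔ (λ { (inj₁ (i≡j , _))        → contradiction i≡j (<⇒≢ i<j)
                          ; (inj₂ (inj₁ (_ , adj)))  → adj
                          ; (inj₂ (inj₂ (j<i , _))) → contradiction j<i (<-asym i<j) })
                       (λ adj → inj₂ (inj₁ (i<j , adj)))

  CrossEdge : ℕ × ℕ → ℕ × ℕ → Set
  CrossEdge x y = Adj s z x y × proj₁ x ≢ proj₁ y

  Quiet : ℕ × ℕ → ℕ × ℕ → ℕ × ℕ → Set
  Quiet x y w = ¬ Adj s z w x × ¬ Adj s z w y

module _ (z : Word) where

  boolSum-adj : ∀ {i j n m} → i ≢ j → Adj boolSum z (i , n) (j , m) ⇔ z n ≢ z m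
  boolSum-adj {i} {j} {n} {m} i≢j = mk⇔ to′ from′
    where
    to′ : Adj boolSum z (i , n) (j , m) → z n ≢ z m
    to′ (inj₁ (i≡j , _))        = contradiction i≡j i≢j
    to′ (inj₂ (inj₁ (_ , adj))) = to (xor≡true⇔≢ (z n) (z m)) adj
    to′ (inj₂ (inj₂ (_ , adj))) = to (xor≡true⇔≢ (z m) (z n)) adj ∘′ sym
    from′ : z n ≢ z m → Adj boolSum z (i , n) (j , m)
    from′ zn≢zm with <-cmp i j
    ... | tri< i<j _ _ = inj₂ (inj₁ (i<j , from (xor≡true⇔≢ (z n) (z m)) zn≢zm))
    ... | tri≈ _ i≡j _ = contradiction i≡j i≢j
    ... | tri> _ _ j<i = inj₂ (inj₂ (j<i , from (xor≡true⇔≢ (z m) (z n)) (zn≢zm ∘′ sym)))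

  boolSum-nonadj : ∀ {i j n m} → i ≢ j → ¬ Adj boolSum z (i , n) (j , m) → z n ≡ z m
  boolSum-nonadj {n = n} {m} i≢j ¬adj with z n ≟ᴮ z m
  ... | yes zn≡zm = zn≡zm
  ... | no  zn≢zm = contradiction (from (boolSum-adj i≢j) zn≢zm) ¬adj

  boolSum-quiet-same-row : ∀ {x y w w′} → CrossEdge boolSum z x y →
                           Quiet boolSum z x y w → Quiet boolSum z x y w′ →
                           proj₁ w ≡ proj₁ w′ → z (proj₂ w) ≡ z (proj₂ w′)
  boolSum-quiet-same-row {x} {y} {w} {w′} (_ , x≢y) (¬wx , ¬wy) (¬w′x , ¬w′y) w≡w′ with proj₁ w ≟ proj₁ x
  ... | no  w≢x = trans (boolSum-nonadj w≢x ¬wx) (sym (boolSum-nonadj (w≢x ∘′ trans w≡w′) ¬w′x))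
  ... | yes w≡x = trans (boolSum-nonadj w≢y ¬wy) (sym (boolSum-nonadj (w≢y ∘′ trans w≡w′) ¬w′y))
    where
    w≢y : proj₁ w ≢ proj₁ y
    w≢y = x≢y ∘′ trans (sym w≡x)

  boolSum-quiet-agree : ∀ {x y w w′} → CrossEdge boolSum z x y →
                        Quiet boolSum z x y w → Quiet boolSum z x y w′ →
                        ¬ Adj boolSum z w w′ → z (proj₂ w) ≡ z (proj₂ w′)
  boolSum-quiet-agree {w = w} {w′} xy qw qw′ ¬ww′ with proj₁ w ≟ proj₁ w′
  ... | yes w≡w′ = boolSum-quiet-same-row xy qw qw′ w≡w′
  ... | no  w≢w′ = boolSum-nonadj w≢w′ ¬ww′

  -- w cannot lie below h (it would see h), so it lies above l, and not seeing l forces its label.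
  proj2-quiet-below : ∀ {l h w} → proj₁ l < proj₁ h → z (proj₂ h) ≡ true →
                      ¬ Adj proj2 z w l → ¬ Adj proj2 z w h → z (proj₂ w) ≡ false
  proj2-quiet-below {l} {h} {w} l<h h-true ¬wl ¬wh with proj₁ w <? proj₁ h
  ... | yes w<h = contradiction (from (Adj-upward proj2 z w<h) h-true) ¬wh
  ... | no  w≮h = ¬-not (¬wl ∘′ Adj-sym proj2 z ∘′ from (Adj-upward proj2 z (<-≤-trans l<h (≮⇒≥ w≮h))))

  proj2-quiet : ∀ {x y w} → CrossEdge proj2 z x y → Quiet proj2 z x y w → z (proj₂ w) ≡ false
  proj2-quiet {x} {y} (xy , x≢y) (¬wx , ¬wy) with <-cmp (proj₁ x) (proj₁ y)
  ... | tri< x<y _ _ = proj2-quiet-below x<y (to (Adj-upward proj2 z x<y) xy) ¬wx ¬wy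
  ... | tri≈ _ x≡y _ = contradiction x≡y x≢y
  ... | tri> _ _ y<x = proj2-quiet-below y<x (to (Adj-upward proj2 z y<x) (Adj-sym proj2 z xy)) ¬wy ¬wx

quiet-same-row-label : ∀ s z {x y w w′} → CrossEdge s z x y → Quiet s z x y w → Quiet s z x y w′ →
                       proj₁ w ≡ proj₁ w′ → z (proj₂ w) ≡ z (proj₂ w′)
quiet-same-row-label boolSum z xy qw qw′ w≡w′ = boolSum-quiet-same-row z xy qw qw′ w≡w′
quiet-same-row-label proj2   z xy qw qw′ _    = trans (proj2-quiet z xy qw) (sym (proj2-quiet z xy qw′))

quiet-cross-nonadj : ∀ s z {x y w₁ w₂ w₃} → CrossEdge s z x y →
                     Quiet s z x y w₁ → Quiet s z x y w₂ → Quiet s z x y w₃ → Quiet s z w₁ w₂ w₃ →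
                     proj₁ w₁ ≢ proj₁ w₂ → ¬ Adj s z w₁ w₂
quiet-cross-nonadj boolSum z xy q₁ q₂ q₃ (¬w₃w₁ , ¬w₃w₂) w₁≢w₂ w₁w₂ =
  to (boolSum-adj z w₁≢w₂) w₁w₂
     (trans (sym (boolSum-quiet-agree z xy q₃ q₁ ¬w₃w₁)) (boolSum-quiet-agree z xy q₃ q₂ ¬w₃w₂))
quiet-cross-nonadj proj2 z {w₁ = w₁} {w₂} xy q₁ q₂ _ _ w₁≢w₂ w₁w₂ with <-cmp (proj₁ w₁) (proj₁ w₂)
... | tri< w₁<w₂ _ _ = false≢true (trans (sym (proj2-quiet z xy q₂)) (to (Adj-upward proj2 z w₁<w₂) w₁w₂))
... | tri≈ _ w₁≡w₂ _ = w₁≢w₂ w₁≡w₂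
... | tri> _ _ w₂<w₁ =
  false≢true (trans (sym (proj2-quiet z xy q₁)) (to (Adj-upward proj2 z w₂<w₁) (Adj-sym proj2 z w₁w₂)))

induced : ∀ {V : Set} (E : V → V → Set) → (∀ {x y} → E x y → E y x) → (∀ {x} → ¬ E x x) →
          ∀ n → (Fin n → V) → FinGraph
induced E E-sym E-irrefl n g = record
  { size = n ; E = λ x y → E (g x) (g y) ; sym = E-sym ; irrefl = E-irrefl }

AgeSub⇒copy : ∀ {V W : Set} {E : V → V → Set} {E′ : W → W → Set} → AgeSub E E′ →
              (E-sym : ∀ {x y} → E x y → E y x) (E-irrefl : ∀ {x} → ¬ E x x) →
              ∀ {n} (g : Fin n → V) → Injective _≡_ _≡_ g →
              Σ (Fin n → W) λ f → Injective _≡_ _≡_ f × (∀ x y → E (g x) (g y) ⇔ E′ (f x) (f y))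
AgeSub⇒copy {E = E} sub E-sym E-irrefl {n} g g-injective
  with sub (induced E E-sym E-irrefl n g) (g , g-injective , λ x y → (λ e → e) , (λ e → e))
... | f , f-injective , f-adj = f , f-injective , λ x y → mk⇔ (proj₁ (f-adj x y)) (proj₂ (f-adj x y))

-- Fans

record Rich (c : ℕ → Bool) (lo hi : ℕ) : Set where
  field
    long : 4 + lo < hi
    t₁ t₂ t₃ f : ℕ
    lo≤t₁ : lo ≤ t₁
    t₁<t₂ : t₁ < t₂
    t₂<t₃ : t₂ < t₃
    t₃<hi : t₃ < hi
    lo≤f  : lo ≤ f
    f<hi  : f < hi
    c-t₁  : c t₁ ≡ true
    c-t₂  : c t₂ ≡ true
    c-t₃  : c t₃ ≡ true
    c-f   : c f ≡ false

  t₂<hi : t₂ < hi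
  t₂<hi = <-trans t₂<t₃ t₃<hi

  t₁<hi : t₁ < hi
  t₁<hi = <-trans t₁<t₂ t₂<hi

  lo≤t₂ : lo ≤ t₂
  lo≤t₂ = ≤-trans lo≤t₁ (<⇒≤ t₁<t₂)

  lo≤t₃ : lo ≤ t₃
  lo≤t₃ = ≤-trans lo≤t₂ (<⇒≤ t₂<t₃)

rich-window : ∀ (c : ℕ → Bool) B → (∀ b j → ∃[ k ] k < B × c (j + k) ≡ b) →
              ∀ lo → Rich c lo (lo + B + B + B + 5)
rich-window c B block lo with block true lo | block true (lo + B) | block true (lo + B + B) | block false lo
... | k₁ , k₁<B , c₁ | k₂ , k₂<B , c₂ | k₃ , k₃<B , c₃ | k₀ , k₀<B , c₀ = record
  { long  = ≤-trans (≤-reflexive (+-comm 5 lo)) (+-monoˡ-≤ 5 (m≤m+n+o+p lo B B B))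
  ; t₁    = lo + k₁
  ; t₂    = lo + B + k₂
  ; t₃    = lo + B + B + k₃
  ; f     = lo + k₀
  ; lo≤t₁ = m≤m+n lo k₁
  ; t₁<t₂ = next-block lo k₁<B k₂
  ; t₂<t₃ = next-block (lo + B) k₂<B k₃
  ; t₃<hi = next-block (lo + B + B) k₃<B 5
  ; lo≤f  = m≤m+n lo k₀
  ; f<hi  = <-≤-trans (+-monoʳ-< lo k₀<B) (m≤m+n+o+p (lo + B) B B 5)
  ; c-t₁  = c₁
  ; c-t₂  = c₂
  ; c-t₃  = c₃
  ; c-f   = c₀
  }
  where
  next-block : ∀ j {k} → k < B → ∀ k′ → j + k < j + B + k′
  next-block j k<B k′ = <-≤-trans (+-monoʳ-< j k<B) (m≤m+n (j + B) k′)

module Fan (s : Star) (z : Word) (L : ℕ) (v : ℕ → ℕ × ℕ) (a : ℕ × ℕ) (c : ℕ → Bool)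
           (v-injective : ∀ {i j} → i < L → j < L → v i ≡ v j → i ≡ j)
           (v-path : ∀ {i j} → i < L → j < L → Adj s z (v i) (v j) ⇔ i ∸abs j ≡ 1)
           (a-fan : ∀ {i} → i < L → Adj s z a (v i) ⇔ c i ≡ true)
           {A D : ℕ} (rich-start : Rich c 0 A) (rich-end : Rich c D L) (gap : 4 + A ≤ D)
  where

  row pos : ℕ → ℕ
  row k = proj₁ (v k)
  pos k = proj₂ (v k)

  row-pos-injective : ∀ {i j} → i < L → j < L → row i ≡ row j → pos i ≡ pos j → i ≡ j
  row-pos-injective i<L j<L row≡ pos≡ = v-injective i<L j<L (cong₂ _,_ row≡ pos≡)

  edge : ∀ {k} → suc k < L → Adj s z (v k) (v (suc k))
  edge {k} k+1<L = from (v-path (<-trans (n<1+n k) k+1<L) k+1<L) (∸abs-suc k)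

  quiet-far : ∀ {k t} → suc k < L → t < L → suc t < k ⊎ suc (suc k) < t → Quiet s z (v k) (v (suc k)) (v t)
  quiet-far {k} {t} k+1<L t<L far =
    nonadj (<-trans (n<1+n k) k+1<L) (Sum.map₂ (<-trans (n<1+n (suc k))) far) ,
    nonadj k+1<L (Sum.map₁ (λ t+1<k → <-trans t+1<k (n<1+n k)) far)
    where
    nonadj : ∀ {j} → j < L → suc t < j ⊎ suc j < t → ¬ Adj s z (v t) (v j)
    nonadj j<L apart = apart⇒∸abs≢1 apart ∘′ to (v-path t<L j<L)

  hub-distance : ∀ {t} → t < L → row t ≡ proj₁ a → c t ≡ true → proj₂ a ∸abs pos t ≡ 1
  hub-distance {t} t<L row≡ c-t = to (Adj-row s z) (subst (λ r → Adj s z a (r , pos t)) row≡ (from (a-fan t<L) c-t))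

  hub-row-neighbours : ∀ {t₁ t₂ t₃} → t₁ < t₂ → t₂ < t₃ → t₃ < L →
                       row t₁ ≡ proj₁ a → row t₂ ≡ proj₁ a → row t₃ ≡ proj₁ a →
                       c t₁ ≡ true → c t₂ ≡ true → c t₃ ≡ true → ⊥
  hub-row-neighbours {t₁} {t₂} {t₃} t₁<t₂ t₂<t₃ t₃<L r₁ r₂ r₃ c₁ c₂ c₃ =
    two-coincide (∸abs≡1-at-most-two (proj₂ a) (hub-distance t₁<L r₁ c₁) (hub-distance t₂<L r₂ c₂)
                                                (hub-distance t₃<L r₃ c₃))
    where
    t₂<L : t₂ < L
    t₂<L = <-trans t₂<t₃ t₃<L
    t₁<L : t₁ < L
    t₁<L = <-trans t₁<t₂ t₂<L
    two-coincide : pos t₁ ≡ pos t₂ ⊎ pos t₂ ≡ pos t₃ ⊎ pos t₁ ≡ pos t₃ → ⊥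
    two-coincide (inj₁ p₁≡p₂) =
      <⇒≢ t₁<t₂ (row-pos-injective t₁<L t₂<L (trans r₁ (sym r₂)) p₁≡p₂)
    two-coincide (inj₂ (inj₁ p₂≡p₃)) =
      <⇒≢ t₂<t₃ (row-pos-injective t₂<L t₃<L (trans r₂ (sym r₃)) p₂≡p₃)
    two-coincide (inj₂ (inj₂ p₁≡p₃)) =
      <⇒≢ (<-trans t₁<t₂ t₂<t₃) (row-pos-injective t₁<L t₃<L (trans r₁ (sym r₃)) p₁≡p₃)

  hub-relabel : ∀ {i j} → i < L → j < L → proj₁ a ≢ row i → row i ≡ row j → z (pos i) ≡ z (pos j) →
                c i ≡ true → c j ≡ true
  hub-relabel {i} {j} i<L j<L a≢i row≡ label≡ c-i =
    to (a-fan j<L) (subst (λ r → Adj s z a (r , pos j)) row≡ (Adj-relabel s z a≢i label≡ (from (a-fan i<L) c-i)))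

  -- A quiet window lies in one row and carries one label. Three hub neighbours cannot share the hub's
  -- row (it has at most two neighbours there), and from another row the hub cannot tell equal labels apart.
  quiet-window-impossible : ∀ {lo hi x y} → Rich c lo hi → hi ≤ L → CrossEdge s z x y →
                            (∀ {t} → lo ≤ t → t < hi → Quiet s z x y (v t)) → ⊥
  quiet-window-impossible {lo} {hi} rich hi≤L xy quiet = hub-placement (proj₁ a ≟ row lo)
    where
    open Rich rich
    in-range : ∀ {t} → t < hi → t < L
    in-range t<hi = <-≤-trans t<hi hi≤L
    lo<hi : lo < hi
    lo<hi = <-trans (m≤n+m (suc lo) 3) long
    far-witness : ∀ {t} → lo ≤ t → ∃[ w ] lo ≤ w × w < hi × (suc w < t ⊎ suc (suc t) < w)
    far-witness {t} lo≤t with suc (suc lo) ≤? t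
    ... | yes lo+2≤t = lo , ≤-refl , lo<hi , inj₁ lo+2≤t
    ... | no  lo+2≰t = 4 + lo , m≤n+m lo 4 , long , inj₂ (s≤s (s≤s (s≤s (≤-pred (≰⇒> lo+2≰t)))))
    row-step : ∀ {t} → lo ≤ t → suc t < hi → row t ≡ row (suc t)
    row-step {t} lo≤t t+1<hi with row t ≟ row (suc t) | far-witness lo≤t
    ... | yes row≡ | _ = row≡
    ... | no  row≢ | w , lo≤w , w<hi , far =
      contradiction (edge (in-range t+1<hi))
        (quiet-cross-nonadj s z xy (quiet lo≤t (<-trans (n<1+n t) t+1<hi)) (quiet (m≤n⇒m≤1+n lo≤t) t+1<hi)
           (quiet lo≤w w<hi) (quiet-far (in-range t+1<hi) (in-range w<hi) far) row≢)
    row-constant : ∀ {t} → lo ≤ t → t < hi → row t ≡ row lo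
    row-constant = step-constant row row-step
    label-constant : ∀ {t} → lo ≤ t → t < hi → z (pos t) ≡ z (pos lo)
    label-constant lo≤t t<hi = quiet-same-row-label s z xy (quiet lo≤t t<hi) (quiet ≤-refl lo<hi) (row-constant lo≤t t<hi)
    hub-placement : Dec (proj₁ a ≡ row lo) → ⊥
    hub-placement (yes a≡lo) =
      hub-row-neighbours t₁<t₂ t₂<t₃ (in-range t₃<hi)
                         (on-a-row lo≤t₁ t₁<hi) (on-a-row lo≤t₂ t₂<hi) (on-a-row lo≤t₃ t₃<hi) c-t₁ c-t₂ c-t₃
      where
      on-a-row : ∀ {t} → lo ≤ t → t < hi → row t ≡ proj₁ a
      on-a-row lo≤t t<hi = trans (row-constant lo≤t t<hi) (sym a≡lo)
    hub-placement (no a≢lo) =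
      false≢true (trans (sym c-f)
        (hub-relabel (in-range t₁<hi) (in-range f<hi) (λ a≡t₁ → a≢lo (trans a≡t₁ (row-constant lo≤t₁ t₁<hi)))
           (trans (row-constant lo≤t₁ t₁<hi) (sym (row-constant lo≤f f<hi)))
           (trans (label-constant lo≤t₁ t₁<hi) (sym (label-constant lo≤f f<hi))) c-t₁))

  A≤L : A ≤ L
  A≤L = ≤-trans (m≤n+m A 4) (≤-trans gap (<⇒≤ (<-trans (m≤n+m (suc D) 3) (Rich.long rich-end))))

  -- A cross edge is far from one of the two rich windows, which would then be quiet.
  row-step : ∀ {k} → suc k < L → row k ≡ row (suc k)
  row-step {k} k+1<L with row k ≟ row (suc k) | k ≤? suc A
  ... | yes row≡ | _ = row≡
  ... | no  row≢ | yes k≤A+1 =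
    ⊥-elim (quiet-window-impossible rich-end ≤-refl (edge k+1<L , row≢)
              (λ D≤t t<L → quiet-far k+1<L t<L (inj₂ (≤-trans (s≤s (s≤s (s≤s k≤A+1))) (≤-trans gap D≤t)))))
  ... | no  row≢ | no  k≰A+1 =
    ⊥-elim (quiet-window-impossible rich-start A≤L (edge k+1<L , row≢)
              (λ _ t<A → quiet-far k+1<L (<-≤-trans t<A A≤L) (inj₁ (≤-trans (s≤s t<A) (<⇒≤ (≰⇒> k≰A+1))))))

  row-constant : ∀ {k} → k < L → row k ≡ row 0
  row-constant = step-constant row (λ _ → row-step) z≤n

  pos-step : ∀ {k} → suc k < L → pos (suc k) ≡ suc (pos k) ⊎ pos k ≡ suc (pos (suc k))
  pos-step {k} k+1<L =
    ∸abs≡1⇒ (pos k) (pos (suc k))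
      (to (Adj-row s z) (subst (λ r → Adj s z (v k) (r , pos (suc k))) (sym (row-step k+1<L)) (edge k+1<L)))

  pos-no-return : ∀ {k} → suc (suc k) < L → pos (suc (suc k)) ≢ pos k
  pos-no-return {k} k+2<L pos≡ = <⇒≢ (<-trans (n<1+n k) (n<1+n (suc k)))
    (sym (row-pos-injective k+2<L k<L (trans (row-constant k+2<L) (sym (row-constant k<L))) pos≡))
    where
    k<L : k < L
    k<L = <-trans (<-trans (n<1+n k) (n<1+n (suc k))) k+2<L

  pos-affine : (∀ {k} → k < L → pos k ≡ pos 0 + k) ⊎ (∀ {k} → k < L → pos k + k ≡ pos 0)
  pos-affine = unit-steps⇒affine pos L pos-step pos-no-return

  hub-off-row : proj₁ a ≢ row 0
  hub-off-row a≡0 =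
    hub-row-neighbours t₁<t₂ t₂<t₃ (in-range t₃<hi) (on-a-row t₁<hi) (on-a-row t₂<hi) (on-a-row t₃<hi) c-t₁ c-t₂ c-t₃
    where
    open Rich rich-start
    in-range : ∀ {t} → t < A → t < L
    in-range t<A = <-≤-trans t<A A≤L
    on-a-row : ∀ {t} → t < A → row t ≡ proj₁ a
    on-a-row t<A = trans (row-constant (in-range t<A)) (sym a≡0)

  c-by-label : ∀ {i j} → i < L → j < L → z (pos i) ≡ z (pos j) → c i ≡ c j
  c-by-label {i} {j} i<L j<L label≡ =
    ≡true-equivalent⇒≡ (hub-relabel i<L j<L (off i<L) row≡ label≡)
                       (hub-relabel j<L i<L (off j<L) (sym row≡) (sym label≡))
    where
    off : ∀ {k} → k < L → proj₁ a ≢ row k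
    off k<L a≡k = hub-off-row (trans a≡k (row-constant k<L))
    row≡ : row i ≡ row j
    row≡ = trans (row-constant i<L) (sym (row-constant j<L))

fan : ∀ L → Fin (suc L) → ℕ × ℕ
fan L zero    = 0 , 0
fan L (suc i) = 1 , toℕ i

fan-injective : ∀ L → Injective _≡_ _≡_ (fan L)
fan-injective L {zero}  {zero}  _  = refl
fan-injective L {suc i} {suc j} eq = cong suc (toℕ-injective (cong proj₂ eq))
fan-injective L {zero}  {suc j} ()
fan-injective L {suc i} {zero}  ()

module FanCopy (s : Star) (u u′ : Word) (sub : AgeSub (Ĝ s u) (Ĝ s u′)) (L : ℕ) where

  copy : Σ (Fin (suc L) → ℕ × ℕ) λ f →
           Injective _≡_ _≡_ f × (∀ x y → Adj s u (fan L x) (fan L y) ⇔ Adj s u′ (f x) (f y))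
  copy = AgeSub⇒copy {E = Adj s u} {E′ = Adj s u′} sub (Adj-sym s u) (Adj-irrefl s u) (fan L) (fan-injective L)

  f : Fin (suc L) → ℕ × ℕ
  f = proj₁ copy

  f-injective : Injective _≡_ _≡_ f
  f-injective = proj₁ (proj₂ copy)

  f-adj : ∀ x y → Adj s u (fan L x) (fan L y) ⇔ Adj s u′ (f x) (f y)
  f-adj = proj₂ (proj₂ copy)

  v : ℕ → ℕ × ℕ
  v k with k <? L
  ... | yes k<L = f (suc (fromℕ< k<L))
  ... | no  _   = f zero  -- junk, never used

  v-fromℕ< : ∀ {k} (k<L : k < L) → v k ≡ f (suc (fromℕ< k<L))
  v-fromℕ< {k} k<L with k <? L
  ... | yes _   = refl
  ... | no  k≮L  = contradiction k<L k≮L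

  a : ℕ × ℕ
  a = f zero

  v-injective : ∀ {i j} → i < L → j < L → v i ≡ v j → i ≡ j
  v-injective {i} {j} i<L j<L eq =
    trans (sym (toℕ-fromℕ< i<L))
      (trans (cong toℕ (Fin.suc-injective (f-injective (trans (sym (v-fromℕ< i<L)) (trans eq (v-fromℕ< j<L))))))
             (toℕ-fromℕ< j<L))

  v-path : ∀ {i j} → i < L → j < L → Adj s u′ (v i) (v j) ⇔ i ∸abs j ≡ 1
  v-path {i} {j} i<L j<L rewrite v-fromℕ< i<L | v-fromℕ< j<L =
    subst₂ (λ p q → Adj s u′ (f (suc (fromℕ< i<L))) (f (suc (fromℕ< j<L))) ⇔ p ∸abs q ≡ 1)
           (toℕ-fromℕ< i<L) (toℕ-fromℕ< j<L)
           (Adj-row s u ⇔-∘ ⇔-sym (f-adj (suc (fromℕ< i<L)) (suc (fromℕ< j<L))))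

  a-fan : ∀ {i} → i < L → Adj s u′ a (v i) ⇔ ⟦ s ⟧ (u 0) (u i) ≡ true
  a-fan {i} i<L rewrite v-fromℕ< i<L =
    subst (λ k → Adj s u′ a (f (suc (fromℕ< i<L))) ⇔ ⟦ s ⟧ (u 0) (u k) ≡ true) (toℕ-fromℕ< i<L)
          (Adj-upward s u z<s ⇔-∘ ⇔-sym (f-adj zero (suc (fromℕ< i<L))))

module AgeInclusion (s : Star) (u u′ : Word) (ur : UniformlyRecurrent u) {N : ℕ} (u-N : u N ≢ u 0)
                    (sub : AgeSub (Ĝ s u) (Ĝ s u′)) (n : ℕ) where

  c : ℕ → Bool
  c k = ⟦ s ⟧ (u 0) (u k)

  c-value : ∀ b → ∃[ p ] c p ≡ b
  c-value b with c 0 ≟ᴮ b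
  ... | yes c-0 = 0 , c-0
  ... | no  c-0 = N , trans (¬-not (u-N ∘′ ⟦⟧-injective s (u 0))) (sym (¬-not (c-0 ∘′ sym)))

  B : ℕ
  B = proj₁ (letter-recurrence u ur)

  c-block : ∀ b j → ∃[ k ] k < B × c (j + k) ≡ b
  c-block b j with c-value b
  ... | p , c-p with proj₂ (letter-recurrence u ur) p j
  ...   | k , k<B , u≡ = k , k<B , trans (cong (⟦ s ⟧ (u 0)) u≡) c-p

  -- The path is a rich window [0, A), a stretch [A, A + M) containing a copy of every factor of u
  -- of length n, a gap, and a rich window [D, L).
  M A D L : ℕ
  M = proj₁ (ur n)
  A = 0 + B + B + B + 5
  D = 4 + (A + M)
  L = D + B + B + B + 5

  rich-start : Rich c 0 A
  rich-start = rich-window c B c-block 0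

  open FanCopy s u u′ sub L
  open Fan s u′ L v a c v-injective v-path a-fan rich-start (rich-window c B c-block D) (+-monoʳ-≤ 4 (m≤m+n A M))

  twist : ∃[ b ] ∀ {k} → k < L → u k ≡ b xor u′ (pos k)
  twist = xor-determined u (u′ ∘′ pos) (λ i<L j<L → ⟦⟧-injective s (u 0) ∘′ c-by-label i<L j<L)
            (<-≤-trans t₁<hi A≤L) (<-≤-trans f<hi A≤L)
            (λ u≡ → false≢true (trans (sym c-f) (trans (cong (⟦ s ⟧ (u 0)) (sym u≡)) c-t₁)))
    where open Rich rich-start

  in-middle : ∀ {k} → k + n ≤ M → A + k + n ≤ L
  in-middle {k} k+n≤M = begin
    A + k + n                  ≡⟨ +-assoc A k n ⟩
    A + (k + n)                ≤⟨ +-monoʳ-≤ A k+n≤M ⟩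
    A + M                      ≤⟨ m≤n+m (A + M) 4 ⟩
    D                          ≤⟨ m≤m+n+o+p D B B B ⟩
    D + B + B + B              ≤⟨ m≤m+n (D + B + B + B) 5 ⟩
    L                          ∎
    where open ≤-Reasoning

  reads : ∃[ σ ] Reads u u′ σ n
  reads with affine⇒windows pos L pos-affine | twist
  ... | r , positions | b , u≡ = (r , b) , occurrence
    where
    occurrence : ∀ i → fac u′ (act (r , b) (window u i n))
    occurrence i with proj₂ (ur n) i A
    ... | k , k+n≤M , same with positions (in-middle k+n≤M)
    ... | P , pos≡ = subst (fac u′) (trans (sym (window-twisted u u′ r b twisted)) (cong (act (r , b)) same))
                           (window-occurs u′ P n)
      where
      twisted : ∀ {t} → t < n → u (A + k + t) ≡ b xor u′ (P + mirror r n t)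
      twisted t<n = trans (u≡ (<-≤-trans (+-monoʳ-< (A + k) t<n) (in-middle k+n≤M)))
                          (cong (λ p → b xor u′ p) (pos≡ t<n))

unrelated⇒¬AgeSub : ∀ s u u′ → UniformlyRecurrent u → ¬ Constant u → UniformlyRecurrent u′ →
                    (∀ σ → ¬ (fac u ≐ image σ (fac u′))) → ¬ AgeSub (Ĝ s u) (Ĝ s u′)
unrelated⇒¬AgeSub s u u′ ur ¬const ur′ unrelated sub = ¬const λ N →
  decidable-stable (u N ≟ᴮ u 0) λ u-N →
    ¬∀∃-Reads u u′ ur′ (λ σ → unrelated σ ∘′ Reads-everywhere⇒fac≐image u u′ σ ur′)
                       (AgeInclusion.reads s u u′ ur u-N sub)

proposition5 : (s : Star) (u u' : Word) →
    UniformlyRecurrent u → ¬ Constant u →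
    UniformlyRecurrent u' → ¬ Constant u' →
    ¬ (fac u ≐ fac u') → ¬ (fac u ≐ (fac u' ᵈ)) →
    ¬ (fac u ≐ (fac u' ∔𝟏)) → ¬ (fac u ≐ ((fac u' ᵈ) ∔𝟏)) →
    ¬ AgeSub (Ĝ s u) (Ĝ s u') × ¬ AgeSub (Ĝ s u') (Ĝ s u)
proposition5 s u u' ur ¬const ur' ¬const' ¬id ¬rev ¬compl ¬revcompl =
  unrelated⇒¬AgeSub s u u' ur ¬const ur' unrelated ,
  unrelated⇒¬AgeSub s u' u ur' ¬const' ur (λ σ → unrelated σ ∘′ ≐-image-swap σ)
  where
  unrelated : ∀ σ → ¬ (fac u ≐ image σ (fac u'))
  unrelated (false , false) = ¬id
  unrelated (true  , false) = ¬rev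
  unrelated (false , true)  = ¬compl
  unrelated (true  , true)  = ¬revcompl
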